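{- Let $w^{(1)},\ldots,w^{(k)}\in S_n$ with $\sum_{i=1}^{k-1}\ell(w^{(i)})+\ell(w_0w^{(k)})=\binom n2$. Let ${\sf Tab}$ be the set of fillings of $D(w^{(1)},\ldots,w^{(k-1)},w_0w^{(k)})$ with nonnegative integers such that (a) columns strictly increase from top to bottom, (b) any label $\ell$ in row $r$ satisfies $\ell\le r$, (c) for each $1\le\ell\le n$ the number of labels $\ell$ is $n-\ell$. Let ${\sf Tab}'$ be the set of fillings of $D(w^{(1)},\ldots,w^{(k-1)})$ with nonnegative integers satisfying (a), (b), and (c') for each $\ell$ the number of labels $\ell$ is $c_\ell(w^{(k)})$. If ${\sf Tab}=\emptyset$ then ${\sf Tab}'=\emptyset$. (That is, whenever the test "${\sf Tab}=\emptyset$" shows $C_{w^{(1)},\ldots,w^{(k-1)},w_0w^{(k)}}=0$, the test "${\sf Tab}'=\emptyset$" also shows $C^{w^{(k)}}_{w^{(1)},\ldots,w^{(k-1)}}=0$.)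
   Context: $\ell(w)=\#\{i<j:w(i)>w(j)\}$ and $w_0=n\,(n-1)\cdots1\in S_n$. The diagram of $w\in S_n$ is $D(w)=\{(i,j)\in[n]\times[n]:j<w(i),\ i<w^{ -1}(j)\}$ (row $i$ numbered top to bottom, column $j$). ${\sf code}(w)=(c_1(w),\ldots,c_n(w))$ where $c_r(w)$ is the number of boxes of $D(w)$ in row $r$. For $v^{(1)},\ldots,v^{(m)}\in S_n$, $D(v^{(1)},\ldots,v^{(m)})\subseteq[n]\times[nm]$ is the concatenation of $D(v^{(1)}),\ldots,D(v^{(m)})$ left to right: the boxes $(i,(t-1)n+j)$ for $1\le t\le m$, $(i,j)\in D(v^{(t)})$. $C_{v^{(1)},\ldots,v^{(m)}}$ is the coefficient of the Schubert class $\sigma_{w_0}$ in $\prod\sigma_{v^{(i)}}$ in $H^*({\sf Flags}(\mathbb C^n))$, and $C^{w}_{v^{(1)},\ldots,v^{(m)}}$ is the coefficient of $\sigma_w$ in that product. -}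

module Defs where

open import Data.Nat using (ℕ; zero; suc; _+_; _∸_; _≤_; _<_)
open import Data.Nat.Combinatorics using (_C_)
open import Data.Bool using (Bool; true; false; if_then_else_; _∧_)
open import Data.Fin using (Fin; toℕ)
import Data.Fin as F
open import Data.Fin.Permutation using (Permutation′; _⟨$⟩ʳ_; _⟨$⟩ˡ_; _∘ₚ_; reverse)
open import Data.Vec using (Vec; lookup; _∷ʳ_)
open import Data.Product using (_×_; _,_)
open import Relation.Binary.PropositionalEquality using (_≡_)
import Data.Nat as N

-- S_n : permutations of Fin n (0-indexed; i ↦ w ⟨$⟩ʳ i, inverse ⟨$⟩ˡ).
S : ℕ → Set
S n = Permutation′ n

ΣFin : ∀ {n} → (Fin n → ℕ) → ℕ
ΣFin {zero}  f = 0
ΣFin {suc n} f = f F.zero + ΣFin (λ i → f (F.suc i))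

ind : Bool → ℕ
ind true  = 1
ind false = 0

len : ∀ {n} → S n → ℕ
len {n} w = ΣFin λ i → ΣFin λ j →
  ind ((toℕ i N.<ᵇ toℕ j) ∧ (toℕ (w ⟨$⟩ʳ j) N.<ᵇ toℕ (w ⟨$⟩ʳ i)))

w₀ : ∀ {n} → S n
w₀ = reverse

-- product w0 w  (apply w first, then w0); note π₁ ∘ₚ π₂ applies π₁ first
w₀· : ∀ {n} → S n → S n
w₀· w = w ∘ₚ w₀

inD : ∀ {n} → S n → Fin n → Fin n → Bool
inD w i j = (toℕ j N.<ᵇ toℕ (w ⟨$⟩ʳ i)) ∧ (toℕ i N.<ᵇ toℕ (w ⟨$⟩ˡ j))

-- code: c_r(w) = number of boxes of D(w) in row r (r = 1..n; Fin index r-1)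
code : ∀ {n} → S n → Fin n → ℕ
code w i = ΣFin λ j → ind (inD w i j)

-- Concatenated diagram D(v⁽¹⁾,…,v⁽ᵐ⁾) ⊆ [n]×[nm]. Column (t-1)n+j is
-- encoded by the pair (t , j) : Fin m × Fin n.
Col : ℕ → ℕ → Set
Col m n = Fin m × Fin n

inDcat : ∀ {m n} → Vec (S n) m → Fin n → Col m n → Bool
inDcat vs i (t , j) = inD (lookup vs t) i j

ΣCol : ∀ {m n} → (Col m n → ℕ) → ℕ
ΣCol f = ΣFin λ t → ΣFin λ j → f (t , j)

-- A filling assigns a nonnegative integer to each cell (only the values on
-- boxes of the diagram matter).
Filling : ℕ → ℕ → Set
Filling m n = Fin n → Col m n → ℕ

ColStrict : ∀ {m n} → Vec (S n) m → Filling m n → Set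
ColStrict vs T = ∀ i i' c → inDcat vs i c ≡ true → inDcat vs i' c ≡ true →
  toℕ i < toℕ i' → T i c < T i' c

-- (b) a label ℓ in row r (1-indexed, r = toℕ i + 1) satisfies ℓ ≤ r
RowBound : ∀ {m n} → Vec (S n) m → Filling m n → Set
RowBound vs T = ∀ i c → inDcat vs i c ≡ true → T i c ≤ suc (toℕ i)

countLabel : ∀ {m n} → Vec (S n) m → Filling m n → ℕ → ℕ
countLabel {n = n} vs T ℓ = ΣFin λ i → ΣCol λ c → ind (inDcat vs i c ∧ (T i c N.≡ᵇ ℓ))

IsTab : ∀ {m n} → Vec (S n) m → S n → Filling (suc m) n → Set
IsTab {n = n} ws wk T =
  ColStrict (ws ∷ʳ w₀· wk) T × RowBound (ws ∷ʳ w₀· wk) T ×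
  (∀ ℓ → 1 ≤ ℓ → ℓ ≤ n → countLabel (ws ∷ʳ w₀· wk) T ℓ ≡ n ∸ ℓ)

IsTab′ : ∀ {m n} → Vec (S n) m → S n → Filling m n → Set
IsTab′ {n = n} ws wk T =
  ColStrict ws T × RowBound ws T ×
  (∀ (r : Fin n) → countLabel ws T (suc (toℕ r)) ≡ code wk r)

lenSum : ∀ {m n} → Vec (S n) m → ℕ
lenSum {m} vs = ΣFin λ t → len (lookup vs t)

-- Fill the extra block D(w₀ w⁽ᵏ⁾) with the label r in every box of row r;
-- this filling is column strict and satisfies (b). Row r of D(w₀ w) has
-- n − r − c_r(w) boxes: after the reflection j ↦ n + 1 − j of the columns its
-- boxes are the j > w(r) with w⁻¹(j) > r, those of row r of D(w) are the
-- j < w(r) with w⁻¹(j) > r, and the n − r columns with w⁻¹(j) > r do not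
-- include w(r). Hence appending this block to a filling in Tab′ raises the
-- c_r(w⁽ᵏ⁾) labels r to exactly n − r, which gives an element of Tab.
module Submission where

open import Defs
open import Data.Nat using (ℕ; zero; suc; _+_; _∸_; _≤_; _<_; s≤s; _<ᵇ_; _≡ᵇ_)
open import Data.Nat.Properties
open import Data.Nat.Combinatorics using (_C_)
open import Data.Bool using (Bool; true; false; _∧_; T)
open import Data.Bool.Properties using (∧-zeroʳ; ∧-identityʳ)
open import Data.Fin using (Fin; toℕ; fromℕ; fromℕ<; inject₁; opposite)
import Data.Fin as F
open import Data.Fin.Properties
  using (toℕ-injective; toℕ<n; toℕ-fromℕ<; opposite-prop; opposite-involutive)
open import Data.Fin.Relation.Unary.Top using (View; view; ‵fromℕ; ‵inject₁; view-fromℕ; view-inject₁)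
open import Data.Fin.Permutation using (Permutation′; _⟨$⟩ʳ_; _⟨$⟩ˡ_; reverse; flip; inverseˡ)
open import Data.Vec using (Vec; []; _∷_; lookup; _∷ʳ_)
open import Data.Product using (∃; _,_)
open import Function using (_∘_)
open import Relation.Binary.Definitions using (tri<; tri≈; tri>)
open import Relation.Binary.PropositionalEquality
  using (_≡_; refl; sym; trans; cong; cong₂; subst; subst₂; module ≡-Reasoning)
open import Relation.Nullary using (¬_; contradiction)
import Algebra.Properties.CommutativeMonoid.Sum as CommutativeMonoidSum

private
  module ℕ-Sum = CommutativeMonoidSum +-0-commutativeMonoid

ΣFin≡sum : ∀ {n} (f : Fin n → ℕ) → ΣFin f ≡ ℕ-Sum.sum f
ΣFin≡sum {zero}  f = refl
ΣFin≡sum {suc n} f = cong (f F.zero +_) (ΣFin≡sum (f ∘ F.suc))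

ΣFin-cong : ∀ {n} {f g : Fin n → ℕ} → (∀ i → f i ≡ g i) → ΣFin f ≡ ΣFin g
ΣFin-cong {f = f} {g} f≗g = begin
  ΣFin f         ≡⟨ ΣFin≡sum f ⟩
  ℕ-Sum.sum f    ≡⟨ ℕ-Sum.sum-cong-≗ f≗g ⟩
  ℕ-Sum.sum g    ≡⟨ ΣFin≡sum g ⟨
  ΣFin g         ∎
  where open ≡-Reasoning

ΣFin-+ : ∀ {n} (f g : Fin n → ℕ) → ΣFin (λ i → f i + g i) ≡ ΣFin f + ΣFin g
ΣFin-+ f g = begin
  ΣFin (λ i → f i + g i)         ≡⟨ ΣFin≡sum (λ i → f i + g i) ⟩
  ℕ-Sum.sum (λ i → f i + g i)    ≡⟨ ℕ-Sum.∑-distrib-+ f g ⟩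
  ℕ-Sum.sum f + ℕ-Sum.sum g      ≡⟨ cong₂ _+_ (ΣFin≡sum f) (ΣFin≡sum g) ⟨
  ΣFin f + ΣFin g                ∎
  where open ≡-Reasoning

ΣFin-zero : ∀ n → ΣFin {n} (λ _ → 0) ≡ 0
ΣFin-zero n = trans (ΣFin≡sum {n} _) (ℕ-Sum.sum-replicate-zero n)

ΣFin-init-last : ∀ {m} (f : Fin (suc m) → ℕ) → ΣFin f ≡ ΣFin (f ∘ inject₁) + f (fromℕ m)
ΣFin-init-last f = begin
  ΣFin f                                    ≡⟨ ΣFin≡sum f ⟩
  ℕ-Sum.sum f                               ≡⟨ ℕ-Sum.sum-init-last f ⟩
  ℕ-Sum.sum (f ∘ inject₁) + f (fromℕ _)     ≡⟨ cong (_+ f (fromℕ _)) (ΣFin≡sum (f ∘ inject₁)) ⟨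
  ΣFin (f ∘ inject₁) + f (fromℕ _)          ∎
  where open ≡-Reasoning

ΣFin-permute : ∀ {n} (f : Fin n → ℕ) (π : Permutation′ n) → ΣFin f ≡ ΣFin (f ∘ (π ⟨$⟩ʳ_))
ΣFin-permute f π = begin
  ΣFin f                        ≡⟨ ΣFin≡sum f ⟩
  ℕ-Sum.sum f                   ≡⟨ ℕ-Sum.sum-permute f π ⟩
  ℕ-Sum.sum (f ∘ (π ⟨$⟩ʳ_))     ≡⟨ ΣFin≡sum (f ∘ (π ⟨$⟩ʳ_)) ⟨
  ΣFin (f ∘ (π ⟨$⟩ʳ_))          ∎
  where open ≡-Reasoning

ΣFin-select : ∀ {n} (g : Fin n → Bool → ℕ) → (∀ i → g i false ≡ 0) →
              ∀ r → ΣFin (λ i → g i (toℕ i ≡ᵇ toℕ r)) ≡ g r true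
ΣFin-select {suc n} g g-false F.zero = begin
  g F.zero true + ΣFin (λ i → g (F.suc i) false)  ≡⟨ cong (g F.zero true +_) (ΣFin-cong (g-false ∘ F.suc)) ⟩
  g F.zero true + ΣFin {n} (λ _ → 0)              ≡⟨ cong (g F.zero true +_) (ΣFin-zero n) ⟩
  g F.zero true + 0                               ≡⟨ +-identityʳ _ ⟩
  g F.zero true                                   ∎
  where open ≡-Reasoning
ΣFin-select {suc n} g g-false (F.suc r) =
  cong₂ _+_ (g-false F.zero) (ΣFin-select (g ∘ F.suc) (g-false ∘ F.suc) r)

count-above : ∀ {n} (i : Fin n) → ΣFin {n} (λ k → ind (toℕ i <ᵇ toℕ k)) ≡ n ∸ suc (toℕ i)
count-above {suc n} F.zero    = all-ones n
  where
  all-ones : ∀ n → ΣFin {n} (λ k → ind (0 <ᵇ suc (toℕ k))) ≡ n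
  all-ones zero    = refl
  all-ones (suc n) = cong suc (all-ones n)
count-above {suc n} (F.suc i) = count-above {n} i

<ᵇ-true : ∀ {a b} → a < b → (a <ᵇ b) ≡ true
<ᵇ-true {a} {b} a<b with a <ᵇ b | <⇒<ᵇ a<b
... | true | _ = refl

<ᵇ-false : ∀ {a b} → ¬ a < b → (a <ᵇ b) ≡ false
<ᵇ-false {a} {b} a≮b with a <ᵇ b in eq
... | false = refl
... | true  = contradiction (<ᵇ⇒< a b (subst T (sym eq) _)) a≮b

T-ext : ∀ {x y : Bool} → (T x → T y) → (T y → T x) → x ≡ y
T-ext {false} {false} _ _ = refl
T-ext {false} {true}  _ g = contradiction (g _) λ ()
T-ext {true}  {false} f _ = contradiction (f _) λ ()
T-ext {true}  {true}  _ _ = refl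

opposite-reverses-< : ∀ {n} {i j : Fin n} → toℕ i < toℕ j → toℕ (opposite j) < toℕ (opposite i)
opposite-reverses-< {i = i} {j} i<j rewrite opposite-prop i | opposite-prop j =
  ∸-monoʳ-< (s≤s i<j) (toℕ<n j)

opposite-<ᵇ : ∀ {n} (i j : Fin n) → (toℕ (opposite i) <ᵇ toℕ (opposite j)) ≡ (toℕ j <ᵇ toℕ i)
opposite-<ᵇ i j = T-ext
  (λ h → <⇒<ᵇ (subst₂ _<_ (involutive j) (involutive i)
                 (opposite-reverses-< (<ᵇ⇒< (toℕ (opposite i)) (toℕ (opposite j)) h))))
  (λ h → <⇒<ᵇ (opposite-reverses-< (<ᵇ⇒< (toℕ j) (toℕ i) h)))
  where
  involutive : ∀ k → toℕ (opposite (opposite k)) ≡ toℕ k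
  involutive k = cong toℕ (opposite-involutive k)

code-w₀· : ∀ {n} (w : S n) (i : Fin n) →
           code (w₀· w) i ≡ ΣFin (λ j → ind ((toℕ (w ⟨$⟩ʳ i) <ᵇ toℕ j) ∧ (toℕ i <ᵇ toℕ (w ⟨$⟩ˡ j))))
code-w₀· w i = trans (ΣFin-permute (ind ∘ inD (w₀· w) i) reverse) (ΣFin-cong λ j →
  cong ind (cong₂ _∧_ (opposite-<ᵇ j (w ⟨$⟩ʳ i))
                      (cong (λ k → toℕ i <ᵇ toℕ (w ⟨$⟩ˡ k)) (opposite-involutive j))))

code+code-w₀· : ∀ {n} (w : S n) (i : Fin n) → code w i + code (w₀· w) i ≡ n ∸ suc (toℕ i)
code+code-w₀· {n} w i = begin
  code w i + code (w₀· w) i              ≡⟨ cong (code w i +_) (code-w₀· w i) ⟩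
  ΣFin left + ΣFin right                 ≡⟨ ΣFin-+ left right ⟨
  ΣFin (λ j → left j + right j)          ≡⟨ ΣFin-cong left+right ⟩
  ΣFin (ind ∘ below)                     ≡⟨ ΣFin-permute (λ k → ind (toℕ i <ᵇ toℕ k)) (flip w) ⟨
  ΣFin {n} (λ k → ind (toℕ i <ᵇ toℕ k))  ≡⟨ count-above i ⟩
  n ∸ suc (toℕ i)                        ∎
  where
  open ≡-Reasoning
  below : Fin n → Bool
  below j = toℕ i <ᵇ toℕ (w ⟨$⟩ˡ j)
  left right : Fin n → ℕ
  left j  = ind ((toℕ j <ᵇ toℕ (w ⟨$⟩ʳ i)) ∧ below j)
  right j = ind ((toℕ (w ⟨$⟩ʳ i) <ᵇ toℕ j) ∧ below j)
  left+right : ∀ j → left j + right j ≡ ind (below j)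
  left+right j with <-cmp (toℕ j) (toℕ (w ⟨$⟩ʳ i))
  ... | tri< j<wi _ j≯wi rewrite <ᵇ-true j<wi | <ᵇ-false j≯wi = +-identityʳ _
  ... | tri> j≮wi _ j>wi rewrite <ᵇ-false j≮wi | <ᵇ-true j>wi = refl
  ... | tri≈ j≮wi j≡wi j≯wi rewrite <ᵇ-false j≮wi | <ᵇ-false j≯wi
      | toℕ-injective j≡wi | inverseˡ w {i} | <ᵇ-false (n≮n (toℕ i)) = refl

lookup-∷ʳ-inject₁ : ∀ {A : Set} {m} (xs : Vec A m) x t → lookup (xs ∷ʳ x) (inject₁ t) ≡ lookup xs t
lookup-∷ʳ-inject₁ (_ ∷ _)  x F.zero    = refl
lookup-∷ʳ-inject₁ (_ ∷ xs) x (F.suc t) = lookup-∷ʳ-inject₁ xs x t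

lookup-∷ʳ-fromℕ : ∀ {A : Set} {m} (xs : Vec A m) x → lookup (xs ∷ʳ x) (fromℕ m) ≡ x
lookup-∷ʳ-fromℕ []       x = refl
lookup-∷ʳ-fromℕ (_ ∷ xs) x = lookup-∷ʳ-fromℕ xs x

inBlock : ∀ {m n} → Filling m n → Filling 1 n → Fin n → Fin n → {t : Fin (suc m)} → View t → ℕ
inBlock T U i j ‵fromℕ        = U i (F.zero , j)
inBlock T U i j (‵inject₁ t) = T i (t , j)

_◁_ : ∀ {m n} → Filling m n → Filling 1 n → Filling (suc m) n
(T ◁ U) i (t , j) = inBlock T U i j (view t)

ColStrict-◁ : ∀ {m n} (vs : Vec (S n) m) x {T U} →
              ColStrict vs T → ColStrict (x ∷ []) U → ColStrict (vs ∷ʳ x) (T ◁ U)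
ColStrict-◁ vs x strictT strictU i i′ (t , j) in₁ in₂ i<i′ with view t
... | ‵fromℕ rewrite lookup-∷ʳ-fromℕ vs x = strictU i i′ (F.zero , j) in₁ in₂ i<i′
... | ‵inject₁ t rewrite lookup-∷ʳ-inject₁ vs x t = strictT i i′ (t , j) in₁ in₂ i<i′

RowBound-◁ : ∀ {m n} (vs : Vec (S n) m) x {T U} →
             RowBound vs T → RowBound (x ∷ []) U → RowBound (vs ∷ʳ x) (T ◁ U)
RowBound-◁ vs x boundT boundU i (t , j) in₁ with view t
... | ‵fromℕ rewrite lookup-∷ʳ-fromℕ vs x = boundU i (F.zero , j) in₁
... | ‵inject₁ t rewrite lookup-∷ʳ-inject₁ vs x t = boundT i (t , j) in₁

countLabel-◁ : ∀ {m n} (vs : Vec (S n) m) x T U ℓ →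
               countLabel (vs ∷ʳ x) (T ◁ U) ℓ ≡ countLabel vs T ℓ + countLabel (x ∷ []) U ℓ
countLabel-◁ {m} {n} vs x T U ℓ = trans (ΣFin-cong split-row) (ΣFin-+ (rowCount vs T) (rowCount (x ∷ []) U))
  where
  rowCount : ∀ {k} → Vec (S n) k → Filling k n → Fin n → ℕ
  rowCount ws W i = ΣCol λ c → ind (inDcat ws i c ∧ (W i c ≡ᵇ ℓ))
  blockCount : Fin n → Fin (suc m) → Fin n → ℕ
  blockCount i t j = ind (inD (lookup (vs ∷ʳ x) t) i j ∧ ((T ◁ U) i (t , j) ≡ᵇ ℓ))
  split-row : ∀ i → rowCount (vs ∷ʳ x) (T ◁ U) i ≡ rowCount vs T i + rowCount (x ∷ []) U i
  split-row i = trans (ΣFin-init-last (λ t → ΣFin (blockCount i t))) (cong₂ _+_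
    (ΣFin-cong λ t → ΣFin-cong λ j → cong ind (cong₂ _∧_
      (cong (λ v → inD v i j) (lookup-∷ʳ-inject₁ vs x t))
      (cong (λ b → inBlock T U i j b ≡ᵇ ℓ) (view-inject₁ t))))
    (trans (ΣFin-cong λ j → cong ind (cong₂ _∧_
      (cong (λ v → inD v i j) (lookup-∷ʳ-fromℕ vs x))
      (cong (λ b → inBlock T U i j b ≡ᵇ ℓ) (view-fromℕ m))))
      (sym (+-identityʳ _))))

rowLabels : ∀ {m n} → Filling m n
rowLabels i _ = suc (toℕ i)

ColStrict-rowLabels : ∀ {m n} (vs : Vec (S n) m) → ColStrict vs rowLabels
ColStrict-rowLabels vs _ _ _ _ _ i<i′ = s≤s i<i′

RowBound-rowLabels : ∀ {m n} (vs : Vec (S n) m) → RowBound vs rowLabels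
RowBound-rowLabels vs _ _ _ = ≤-refl

countLabel-rowLabels : ∀ {n} (v : S n) r → countLabel (v ∷ []) rowLabels (suc (toℕ r)) ≡ code v r
countLabel-rowLabels {n} v r = begin
  ΣFin (λ i → rowWith i (toℕ i ≡ᵇ toℕ r))  ≡⟨ ΣFin-select rowWith rowWith-false r ⟩
  rowWith r true                           ≡⟨ +-identityʳ _ ⟩
  ΣFin (λ j → ind (inD v r j ∧ true))      ≡⟨ ΣFin-cong (λ j → cong ind (∧-identityʳ (inD v r j))) ⟩
  code v r                                 ∎
  where
  open ≡-Reasoning
  -- the trailing + 0 is ΣCol over the single block; suc a ≡ᵇ suc b reduces to a ≡ᵇ b
  rowWith : Fin n → Bool → ℕ
  rowWith i b = ΣFin (λ j → ind (inD v i j ∧ b)) + 0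
  rowWith-false : ∀ i → rowWith i false ≡ 0
  rowWith-false i = begin
    ΣFin (λ j → ind (inD v i j ∧ false)) + 0  ≡⟨ +-identityʳ _ ⟩
    ΣFin (λ j → ind (inD v i j ∧ false))      ≡⟨ ΣFin-cong (λ j → cong ind (∧-zeroʳ (inD v i j))) ⟩
    ΣFin {n} (λ _ → 0)                        ≡⟨ ΣFin-zero n ⟩
    0                                         ∎

∀-1≤ℓ≤n-fromFin : ∀ {n} {P : ℕ → Set} → (∀ (r : Fin n) → P (suc (toℕ r))) → ∀ ℓ → 1 ≤ ℓ → ℓ ≤ n → P ℓ
∀-1≤ℓ≤n-fromFin {P = P} p (suc ℓ) _ ℓ<n = subst (P ∘ suc) (toℕ-fromℕ< ℓ<n) (p (fromℕ< ℓ<n))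

Tab′→Tab : ∀ {m n} (ws : Vec (S n) m) wk {T} → IsTab′ ws wk T → IsTab ws wk (T ◁ rowLabels)
Tab′→Tab {n = n} ws wk {T} (strict , bound , count) =
  ColStrict-◁ ws (w₀· wk) strict (ColStrict-rowLabels (w₀· wk ∷ [])) ,
  RowBound-◁ ws (w₀· wk) bound (RowBound-rowLabels (w₀· wk ∷ [])) ,
  ∀-1≤ℓ≤n-fromFin count′
  where
  open ≡-Reasoning
  count′ : ∀ r → countLabel (ws ∷ʳ w₀· wk) (T ◁ rowLabels) (suc (toℕ r)) ≡ n ∸ suc (toℕ r)
  count′ r = begin
    countLabel (ws ∷ʳ w₀· wk) (T ◁ rowLabels) (suc (toℕ r))
      ≡⟨ countLabel-◁ ws (w₀· wk) T rowLabels (suc (toℕ r)) ⟩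
    countLabel ws T (suc (toℕ r)) + countLabel (w₀· wk ∷ []) rowLabels (suc (toℕ r))
      ≡⟨ cong₂ _+_ (count r) (countLabel-rowLabels (w₀· wk) r) ⟩
    code wk r + code (w₀· wk) r
      ≡⟨ code+code-w₀· wk r ⟩
    n ∸ suc (toℕ r) ∎

proposition4p8 : ∀ (n m : ℕ) (ws : Vec (S n) m) (wk : S n) →
    lenSum ws + len (w₀· wk) ≡ n C 2 →
    ¬ (∃ λ T → IsTab ws wk T) →
    ¬ (∃ λ T → IsTab′ ws wk T)
proposition4p8 n m ws wk _ noTab (T , tab′) = noTab (T ◁ rowLabels , Tab′→Tab ws wk tab′)
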